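{- Let $G=(V,E)$ be an undirected graph and $k$ a positive integer, and let $\mathrm{OPT}$ denote the number of vertices dominated by an optimal solution of the Budgeted Connected Dominating Set instance $(G,k)$. Let $D$ and $p$ be the output of the Greedy Dominating Set procedure on $G$. Then there exists a subset $D'\subseteq D$ with $|D'|\le k$ such that $\sum_{v\in D'}p(v)\ge(1-\frac1e)\mathrm{OPT}$. Further, there is a set $S\subseteq V$ of at most $2k$ vertices such that $D'\cup S$ induces a connected subgraph of $G$.
   Context: For $v\in V$, $N[v]$ denotes the closed neighborhood of $v$. A set $S\subseteq V$ dominates $w$ if $w\in N[s]$ for some $s\in S$. Budgeted Connected Dominating Set problem: given $G$ and an integer budget $k$, find $S\subseteq V$ with $|S|\le k$ inducing a connected subgraph of $G$ that maximizes the number of vertices dominated by $S$. Greedy Dominating Set procedure: set $D=\emptyset$, $U=V$, $p(v)=0$ for all $v$; while $U\neq\emptyset$: choose $v\in V\setminus D$ maximizing $|N[v]\cap U|$ (ties arbitrary), set $C_v=N[v]\cap U$, $p(v)=|C_v|$, $U\leftarrow U\setminus C_v$, $D\leftarrow D\cup\{v\}$. -}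

module Defs where

open import Data.Nat using (ℕ; zero; suc; _+_; _*_; _∸_; _≤_; _!)

open import Data.Bool using (Bool; true; false; _∨_; _∧_; if_then_else_)
open import Data.Fin using (Fin; zero; suc)
open import Data.Fin.Properties using (_≟_)
open import Data.Fin.Subset using (Subset; Side; inside; outside; _∈_; _∉_; _∩_; _∪_; _─_; ⁅_⁆; ⊥; ⊤; ∣_∣; Nonempty; _⊆_)
open import Data.Vec using (Vec; []; _∷_; tabulate; lookup)
open import Data.Product using (Σ; _×_; _,_; ∃)
open import Relation.Nullary using (¬_)
open import Relation.Nullary.Decidable using (⌊_⌋)
open import Relation.Binary.PropositionalEquality using (_≡_)

record Graph (n : ℕ) : Set where
  field
    adj    : Fin n → Fin n → Bool
    sym    : ∀ u v → adj u v ≡ adj v u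
    irrefl : ∀ v → adj v v ≡ false
open Graph public

anyFin : ∀ {m} → (Fin m → Bool) → Bool
anyFin {zero}  f = false
anyFin {suc m} f = f zero ∨ anyFin (λ i → f (suc i))

isIn : Side → Bool
isIn inside  = true
isIn outside = false

fromBool : Bool → Side
fromBool true  = inside
fromBool false = outside

sumOver : ∀ {n} → Subset n → (Fin n → ℕ) → ℕ
sumOver []             f = 0
sumOver (inside  ∷ s) f = f zero + sumOver s (λ i → f (suc i))
sumOver (outside ∷ s) f = sumOver s (λ i → f (suc i))

module _ {n : ℕ} (G : Graph n) where

  N[_] : Fin n → Subset n
  N[ v ] = tabulate (λ w → fromBool (⌊ v ≟ w ⌋ ∨ adj G v w))

  dominated : Subset n → Subset n
  dominated S = tabulate (λ w → fromBool (anyFin (λ s → isIn (lookup S s) ∧ isIn (lookup N[ s ] w))))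

  data WalkIn (S : Subset n) : Fin n → Fin n → Set where
    here : ∀ {u} → u ∈ S → WalkIn S u u
    step : ∀ {u w v} → u ∈ S → adj G u w ≡ true → WalkIn S w v → WalkIn S u v

  InducesConnected : Subset n → Set
  InducesConnected S = ∀ u v → u ∈ S → v ∈ S → WalkIn S u v

  Feasible : ℕ → Subset n → Set
  Feasible k S = ∣ S ∣ ≤ k × InducesConnected S

  IsOPT : ℕ → ℕ → Set
  IsOPT k opt = (Σ (Subset n) λ S → Feasible k S × ∣ dominated S ∣ ≡ opt)
              × (∀ S → Feasible k S → ∣ dominated S ∣ ≤ opt)

  -- The Greedy Dominating Set procedure, as a relation on its states
  -- (D , U , p).  Ties are broken arbitrarily: any admissible choice is
  -- allowed.

  record State : Set where
    constructor ⟨_,_,_⟩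
    field
      D : Subset n
      U : Subset n
      p : Fin n → ℕ

  data Step : State → State → Set where
    pick : ∀ {D U p} (v : Fin n) →
           Nonempty U →
           v ∉ D →
           (∀ w → w ∉ D → ∣ N[ w ] ∩ U ∣ ≤ ∣ N[ v ] ∩ U ∣) →
           Step ⟨ D , U , p ⟩
                ⟨ D ∪ ⁅ v ⁆ , U ─ N[ v ] ,
                  (λ w → if ⌊ w ≟ v ⌋ then ∣ N[ v ] ∩ U ∣ else p w) ⟩

  data Steps : State → State → Set where
    done : ∀ {s} → Steps s s
    more : ∀ {s t u} → Step s t → Steps t u → Steps s u

  GreedyOutput : Subset n → (Fin n → ℕ) → Set
  GreedyOutput D p = Steps ⟨ ⊥ , ⊤ , (λ _ → 0) ⟩ ⟨ D , ⊥ , p ⟩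

-- The real inequality  a ≥ (1 - 1/e) · b  for naturals a, b,
-- expressed without reals.  With e_m = Σ_{i ≤ m} 1/i!  (increasing, with
-- supremum e), a ≥ (1-1/e) b  ⇔  (b - a) · e ≤ b  ⇔  ∀ m, (b ∸ a) · e_m ≤ b
-- (if a ≥ b both sides hold trivially).  Multiplying by m! gives
-- ∀ m, (b ∸ a) · eNum m ≤ b · m!,  where eNum m = Σ_{i ≤ m} m!/i!, which
-- satisfies eNum 0 = 1, eNum (m+1) = (m+1) · eNum m + 1.

eNum : ℕ → ℕ
eNum zero    = 1
eNum (suc m) = suc m * eNum m + 1

AtLeastOneMinusInvE : ℕ → ℕ → Set
AtLeastOneMinusInvE a b = ∀ m → (b ∸ a) * eNum m ≤ b * (m !)

{-# OPTIONS --safe #-}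
-- Fix an optimal S* and let X be the set it dominates, so |X| = OPT. Along the greedy run, put into D′
-- each of the first k chosen v whose C_v meets X, together with a witness w ∈ C_v ∩ X into W. While
-- fewer than k are taken, OPT ≤ Σ_{D′} p + |X ∩ U|, and X ∩ U is covered by the at most k sets
-- N[s] ∩ U (s ∈ S*), each of size at most p(v) by the greedy choice; so every taken v shrinks the gap
-- OPT - Σ_{D′} p by a factor 1 - 1/k, leaving at most (1 - 1/k)^k OPT ≤ OPT/e after k of them. If fewer
-- are taken, U runs empty and the gap closes. Each v ∈ D′ has its w in N[v], each w lies in N[s] for
-- some s ∈ S*, and S* is connected, so S = W ∪ S* connects D′.
module Submission where

open import Defs hiding (sym)
open import Data.Bool using (Bool; true; false; _∨_; if_then_else_)
open import Data.Bool.Properties using (∧-conicalˡ; ∧-conicalʳ)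
open import Data.Empty using (⊥-elim)
open import Data.Fin using (Fin; zero; suc)
open import Data.Fin.Properties using (_≟_)
open import Data.Fin.Subset using (Subset; Side; inside; outside; _∈_; _∉_; _∩_; _∪_; _─_; ⁅_⁆; ⊥; ⊤; ∣_∣; Empty; _⊆_)
open import Data.Fin.Subset.Properties
  using (x∈p∪q⁻; x∈p∪q⁺; x∈p∩q⁻; x∈p∩q⁺; p⊆p∪q; q⊆p∪q; x∈p∧x∉q⇒x∈p─q; p⊆q⇒∣p∣≤∣q∣; ∣p∩q∣≤∣p∣;
         ∣⊥∣≡0; ∣⁅x⁆∣≡1; Empty-unique; x∈⁅x⁆; x∈⁅y⁆⇒x≡y; ∉⊥; ∪-identityʳ; ∩-identityʳ; ∩-zeroʳ; _∈?_; nonempty?)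
open import Data.Nat using (ℕ; zero; suc; _+_; _*_; _∸_; _^_; _≤_; _<_; z≤n; s≤s; _!; _<?_)
open import Data.Nat.Properties
  using (≤-refl; ≤-reflexive; ≤-trans; ≤-total; ≤∧≮⇒≡; n≤1+n; m≤m+n; m≤n*m; module ≤-Reasoning;
         +-assoc; +-comm; +-suc; +-identityʳ; *-zeroʳ; *-distribˡ-+; *-commutativeSemigroup; m^n≢0;
         +-mono-≤; +-monoˡ-≤; +-monoʳ-≤; *-monoˡ-≤; *-monoʳ-≤; ^-monoˡ-≤; +-cancelˡ-≤; *-cancelˡ-≤;
         m∸n+n≡m; m≤n⇒m∸n≡0; ∸-+-assoc; m≤n+o⇒m∸n≤o)
open import Data.Nat.Tactic.RingSolver using (solve-∀)
open import Algebra.Properties.CommutativeSemigroup *-commutativeSemigroup using (x∙yz≈y∙xz; xy∙z≈y∙xz)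
open import Data.Product using (Σ; ∃; _×_; _,_; proj₁; proj₂)
open import Data.Sum using (_⊎_; inj₁; inj₂)
open import Data.Vec using ([]; _∷_; here; there; tabulate)
open import Data.Vec.Properties using (lookup∘tabulate; []=⇒lookup; lookup⇒[]=)
open import Function using (_∘_)
open import Relation.Nullary using (yes; no)
open import Relation.Nullary.Decidable using (⌊_⌋)
open import Relation.Binary.PropositionalEquality using (_≡_; _≢_; refl; sym; trans; cong; cong₂; subst)

private
  variable
    n : ℕ

-- expTaylor k m j = k^m m! T_m(j/k), where T_m(x) = Σ_{i ≤ m} x^i / i! is the Taylor polynomial of exp.
expTaylor : ℕ → ℕ → ℕ → ℕ
expTaylor k zero    j = 1
expTaylor k (suc m) j = suc m * k * expTaylor k m j + j ^ suc m

expTaylor-at-0 : ∀ k m → expTaylor k m 0 ≡ k ^ m * m !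
expTaylor-at-0 k zero    = refl
expTaylor-at-0 k (suc m) rewrite expTaylor-at-0 k m = identity (suc m) k (k ^ m) (m !)
  where
  identity : ∀ c k a f → c * k * (a * f) + 0 ≡ k * a * (c * f)
  identity = solve-∀

expTaylor-at-k : ∀ k m → expTaylor k m k ≡ k ^ m * eNum m
expTaylor-at-k k zero    = refl
expTaylor-at-k k (suc m) rewrite expTaylor-at-k k m = identity (suc m) k (k ^ m) (eNum m)
  where
  identity : ∀ c k a e → c * k * (a * e) + k * a ≡ k * a * (c * e + 1)
  identity = solve-∀

suc-^-mean-value : ∀ j m → suc j ^ suc m ≤ j ^ suc m + suc m * suc j ^ m
suc-^-mean-value j zero    = ≤-reflexive (identity j)
  where
  identity : ∀ j → (1 + j) * 1 ≡ j * 1 + 1 * 1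
  identity = solve-∀
suc-^-mean-value j (suc m) = begin
  suc j * suc j ^ c
    ≤⟨ *-monoʳ-≤ (suc j) (suc-^-mean-value j m) ⟩
  suc j * (j ^ c + c * suc j ^ m)
    ≡⟨ expand j (j ^ c) (suc j ^ m) m ⟩
  j * j ^ c + j ^ c + c * suc j ^ c
    ≤⟨ +-monoˡ-≤ (c * suc j ^ c) (+-monoʳ-≤ (j * j ^ c) (^-monoˡ-≤ c (n≤1+n j))) ⟩
  j * j ^ c + suc j ^ c + c * suc j ^ c
    ≡⟨ +-assoc (j * j ^ c) _ _ ⟩
  j ^ suc c + suc c * suc j ^ c
    ∎
  where
  open ≤-Reasoning
  c = suc m
  expand : ∀ j a b m → (1 + j) * (a + (1 + m) * b) ≡ j * a + a + (1 + m) * ((1 + j) * b)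
  expand = solve-∀

-- At x = j/k and h = 1/k this is T_m(x + h) - T_m(x) ≤ h (T_m(x + h) - (x + h)^m / m!), the mean-value
-- bound for T_m, whose derivative T_m - x^m / m! is increasing.
expTaylor-increment : ∀ k m j → k * expTaylor k m (suc j) + suc j ^ m ≤ k * expTaylor k m j + expTaylor k m (suc j)
expTaylor-increment k zero    j = ≤-refl
expTaylor-increment k (suc m) j = begin
  k * (c * k * A + suc j ^ c) + suc j ^ c
    ≡⟨ regroup₁ k c A (suc j ^ c) ⟩
  c * k * (k * A) + k * suc j ^ c + suc j ^ c
    ≤⟨ +-monoˡ-≤ (suc j ^ c) (+-monoʳ-≤ (c * k * (k * A)) (*-monoʳ-≤ k (suc-^-mean-value j m))) ⟩
  c * k * (k * A) + k * (j ^ c + c * suc j ^ m) + suc j ^ c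
    ≡⟨ regroup₂ k c A (suc j ^ c) (j ^ c) (suc j ^ m) ⟩
  c * k * (k * A + suc j ^ m) + k * j ^ c + suc j ^ c
    ≤⟨ +-monoˡ-≤ (suc j ^ c) (+-monoˡ-≤ (k * j ^ c) (*-monoʳ-≤ (c * k) (expTaylor-increment k m j))) ⟩
  c * k * (k * B + A) + k * j ^ c + suc j ^ c
    ≡⟨ regroup₃ k c A B (suc j ^ c) (j ^ c) ⟩
  k * (c * k * B + j ^ c) + (c * k * A + suc j ^ c)
    ∎
  where
  open ≤-Reasoning
  c = suc m
  A = expTaylor k m (suc j)
  B = expTaylor k m j
  regroup₁ : ∀ k c A s → k * (c * k * A + s) + s ≡ c * k * (k * A) + k * s + s
  regroup₁ = solve-∀
  regroup₂ : ∀ k c A s t q → c * k * (k * A) + k * (t + c * q) + s ≡ c * k * (k * A + q) + k * t + s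
  regroup₂ = solve-∀
  regroup₃ : ∀ k c A B s t → c * k * (k * B + A) + k * t + s ≡ k * (c * k * B + t) + (c * k * A + s)
  regroup₃ = solve-∀

-- g ≤ e^(-c/k) b, stated without reals as g T_m(c/k) ≤ b for every m.
ExpDecayBound : ℕ → ℕ → ℕ → ℕ → Set
ExpDecayBound k c g b = ∀ m → g * expTaylor k m c ≤ b * expTaylor k m 0

∸-≤-contraction : ∀ k g p → 1 ≤ k → g ≤ k * p → k * (g ∸ p) + g ≤ k * g
∸-≤-contraction k@(suc _) g p _ g≤kp with ≤-total g p
... | inj₁ g≤p rewrite m≤n⇒m∸n≡0 g≤p | *-zeroʳ k = m≤n*m g k
... | inj₂ p≤g = begin
  k * (g ∸ p) + g              ≡⟨ cong (k * (g ∸ p) +_) (sym (m∸n+n≡m p≤g)) ⟩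
  k * (g ∸ p) + (g ∸ p + p)    ≤⟨ +-monoʳ-≤ (k * (g ∸ p)) (≤-trans (≤-reflexive (m∸n+n≡m p≤g)) g≤kp) ⟩
  k * (g ∸ p) + k * p          ≡⟨ sym (*-distribˡ-+ k (g ∸ p) p) ⟩
  k * (g ∸ p + p)              ≡⟨ cong (k *_) (m∸n+n≡m p≤g) ⟩
  k * g                        ∎
  where open ≤-Reasoning

-- Multiply g′ ≤ (1 - 1/k) g by (1 - 1/k) X ≤ Y.
*-≤-via-ratio : ∀ k g g′ X Y → 1 ≤ k → k * g′ + g ≤ k * g → k * X ≤ k * Y + X → g′ * X ≤ g * Y
*-≤-via-ratio k@(suc _) g g′ X Y _ g′≤ X≤ =
  *-cancelˡ-≤ k (+-cancelˡ-≤ (g * X) (k * (g′ * X)) (k * (g * Y)) (begin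
    g * X + k * (g′ * X)   ≡⟨ regroup₁ g X k g′ ⟩
    (k * g′ + g) * X       ≤⟨ *-monoˡ-≤ X g′≤ ⟩
    k * g * X              ≡⟨ xy∙z≈y∙xz k g X ⟩
    g * (k * X)            ≤⟨ *-monoʳ-≤ g X≤ ⟩
    g * (k * Y + X)        ≡⟨ regroup₂ g X k Y ⟩
    g * X + k * (g * Y)    ∎))
  where
  open ≤-Reasoning
  regroup₁ : ∀ g X k g′ → g * X + k * (g′ * X) ≡ (k * g′ + g) * X
  regroup₁ = solve-∀
  regroup₂ : ∀ g X k Y → g * (k * Y + X) ≡ g * X + k * (g * Y)
  regroup₂ = solve-∀

expDecayBound-step : ∀ k c g p b → 1 ≤ k → g ≤ k * p → ExpDecayBound k c g b → ExpDecayBound k (suc c) (g ∸ p) b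
expDecayBound-step k c g p b 1≤k g≤kp bound m = ≤-trans
  (*-≤-via-ratio k g (g ∸ p) (expTaylor k m (suc c)) (expTaylor k m c) 1≤k (∸-≤-contraction k g p 1≤k g≤kp)
    (≤-trans (m≤m+n _ (suc c ^ m)) (expTaylor-increment k m c)))
  (bound m)

atLeastOneMinusInvE : ∀ k a b → 1 ≤ k → ExpDecayBound k k (b ∸ a) b → AtLeastOneMinusInvE a b
atLeastOneMinusInvE k@(suc _) a b _ bound m = *-cancelˡ-≤ (k ^ m) {{m^n≢0 k m}} (begin
  k ^ m * ((b ∸ a) * eNum m)   ≡⟨ x∙yz≈y∙xz (k ^ m) (b ∸ a) (eNum m) ⟩
  (b ∸ a) * (k ^ m * eNum m)   ≡⟨ cong ((b ∸ a) *_) (sym (expTaylor-at-k k m)) ⟩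
  (b ∸ a) * expTaylor k m k    ≤⟨ bound m ⟩
  b * expTaylor k m 0          ≡⟨ cong (b *_) (expTaylor-at-0 k m) ⟩
  b * (k ^ m * m !)            ≡⟨ x∙yz≈y∙xz b (k ^ m) (m !) ⟩
  k ^ m * (b * m !)            ∎)
  where open ≤-Reasoning

∣p∪q∣≤∣p∣+∣q∣ : ∀ (p q : Subset n) → ∣ p ∪ q ∣ ≤ ∣ p ∣ + ∣ q ∣
∣p∪q∣≤∣p∣+∣q∣ []            []            = z≤n
∣p∪q∣≤∣p∣+∣q∣ (inside  ∷ p) (inside  ∷ q) = s≤s (≤-trans (∣p∪q∣≤∣p∣+∣q∣ p q) (+-monoʳ-≤ ∣ p ∣ (n≤1+n ∣ q ∣)))
∣p∪q∣≤∣p∣+∣q∣ (inside  ∷ p) (outside ∷ q) = s≤s (∣p∪q∣≤∣p∣+∣q∣ p q)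
∣p∪q∣≤∣p∣+∣q∣ (outside ∷ p) (inside  ∷ q) =
  subst (suc ∣ p ∪ q ∣ ≤_) (sym (+-suc ∣ p ∣ ∣ q ∣)) (s≤s (∣p∪q∣≤∣p∣+∣q∣ p q))
∣p∪q∣≤∣p∣+∣q∣ (outside ∷ p) (outside ∷ q) = ∣p∪q∣≤∣p∣+∣q∣ p q

∣p∪⁅x⁆∣≤1+∣p∣ : ∀ (p : Subset n) x → ∣ p ∪ ⁅ x ⁆ ∣ ≤ suc ∣ p ∣
∣p∪⁅x⁆∣≤1+∣p∣ p x = begin
  ∣ p ∪ ⁅ x ⁆ ∣       ≤⟨ ∣p∪q∣≤∣p∣+∣q∣ p ⁅ x ⁆ ⟩
  ∣ p ∣ + ∣ ⁅ x ⁆ ∣   ≡⟨ cong (∣ p ∣ +_) (∣⁅x⁆∣≡1 x) ⟩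
  ∣ p ∣ + 1           ≡⟨ +-comm ∣ p ∣ 1 ⟩
  suc ∣ p ∣           ∎
  where open ≤-Reasoning

∣Empty∣≡0 : ∀ {p : Subset n} → Empty p → ∣ p ∣ ≡ 0
∣Empty∣≡0 {n} empty rewrite Empty-unique empty = ∣⊥∣≡0 n

x∈p─q⁻ : ∀ (p q : Subset n) {x} → x ∈ p ─ q → x ∈ p × x ∉ q
x∈p─q⁻ (inside  ∷ p) (outside ∷ q) here = here , λ ()
x∈p─q⁻ (outside ∷ p) (inside  ∷ q) {zero} ()
x∈p─q⁻ (outside ∷ p) (outside ∷ q) {zero} ()
x∈p─q⁻ (_ ∷ p) (_ ∷ q) (there x∈p─q) with x∈p─q⁻ p q x∈p─q
... | x∈p , x∉q = there x∈p , λ { (there x∈q) → x∉q x∈q }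

∪-⁅⁆-⊆ : ∀ {p q : Subset n} {x} → p ⊆ q → x ∈ q → p ∪ ⁅ x ⁆ ⊆ q
∪-⁅⁆-⊆ {p = p} {x = x} p⊆q x∈q y∈ with x∈p∪q⁻ p ⁅ x ⁆ y∈
... | inj₁ y∈p  = p⊆q y∈p
... | inj₂ y∈⁅x⁆ rewrite x∈⁅y⁆⇒x≡y x y∈⁅x⁆ = x∈q

∣p∩q∣≤∣[r∩q]∩p∣+∣p∩[q─r]∣ : ∀ (p q r : Subset n) → ∣ p ∩ q ∣ ≤ ∣ (r ∩ q) ∩ p ∣ + ∣ p ∩ (q ─ r) ∣
∣p∩q∣≤∣[r∩q]∩p∣+∣p∩[q─r]∣ p q r = ≤-trans (p⊆q⇒∣p∣≤∣q∣ split) (∣p∪q∣≤∣p∣+∣q∣ ((r ∩ q) ∩ p) (p ∩ (q ─ r)))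
  where
  split : p ∩ q ⊆ (r ∩ q) ∩ p ∪ p ∩ (q ─ r)
  split {x} x∈ with x∈p∩q⁻ p q x∈ | x ∈? r
  ... | x∈p , x∈q | yes x∈r = x∈p∪q⁺ (inj₁ (x∈p∩q⁺ (x∈p∩q⁺ (x∈r , x∈q) , x∈p)))
  ... | x∈p , x∈q | no  x∉r = x∈p∪q⁺ (inj₂ (x∈p∩q⁺ (x∈p , x∈p∧x∉q⇒x∈p─q x∈q x∉r)))

bigUnion : ∀ {m} → Subset m → (Fin m → Subset n) → Subset n
bigUnion []            A = ⊥
bigUnion (inside  ∷ S) A = A zero ∪ bigUnion S (A ∘ suc)
bigUnion (outside ∷ S) A = bigUnion S (A ∘ suc)

∈-bigUnion⁺ : ∀ {m} (S : Subset m) (A : Fin m → Subset n) {s x} → s ∈ S → x ∈ A s → x ∈ bigUnion S A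
∈-bigUnion⁺ (inside  ∷ S) A here       x∈ = x∈p∪q⁺ (inj₁ x∈)
∈-bigUnion⁺ (inside  ∷ S) A (there s∈) x∈ = x∈p∪q⁺ (inj₂ (∈-bigUnion⁺ S (A ∘ suc) s∈ x∈))
∈-bigUnion⁺ (outside ∷ S) A (there s∈) x∈ = ∈-bigUnion⁺ S (A ∘ suc) s∈ x∈

∣bigUnion∣≤sumOver : ∀ {m} (S : Subset m) (A : Fin m → Subset n) → ∣ bigUnion S A ∣ ≤ sumOver S (λ s → ∣ A s ∣)
∣bigUnion∣≤sumOver {n} []  A = ≤-reflexive (∣⊥∣≡0 n)
∣bigUnion∣≤sumOver (inside ∷ S) A =
  ≤-trans (∣p∪q∣≤∣p∣+∣q∣ (A zero) _) (+-monoʳ-≤ ∣ A zero ∣ (∣bigUnion∣≤sumOver S (A ∘ suc)))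
∣bigUnion∣≤sumOver (outside ∷ S) A = ∣bigUnion∣≤sumOver S (A ∘ suc)

sumOver-⊥ : ∀ n (f : Fin n → ℕ) → sumOver ⊥ f ≡ 0
sumOver-⊥ zero    f = refl
sumOver-⊥ (suc n) f = sumOver-⊥ n (f ∘ suc)

sumOver-cong : ∀ (S : Subset n) {f g : Fin n → ℕ} → (∀ {i} → i ∈ S → f i ≡ g i) → sumOver S f ≡ sumOver S g
sumOver-cong []            f≡g = refl
sumOver-cong (inside  ∷ S) f≡g = cong₂ _+_ (f≡g here) (sumOver-cong S (f≡g ∘ there))
sumOver-cong (outside ∷ S) f≡g = sumOver-cong S (f≡g ∘ there)

sumOver-∪-⁅⁆ : ∀ (S : Subset n) (f : Fin n → ℕ) {v} → v ∉ S → sumOver (S ∪ ⁅ v ⁆) f ≡ sumOver S f + f v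
sumOver-∪-⁅⁆ (inside  ∷ S) f {zero}  v∉S = ⊥-elim (v∉S here)
sumOver-∪-⁅⁆ (outside ∷ S) f {zero}  v∉S rewrite ∪-identityʳ S = +-comm (f zero) _
sumOver-∪-⁅⁆ (inside  ∷ S) f {suc v} v∉S
  rewrite sumOver-∪-⁅⁆ S (f ∘ suc) (v∉S ∘ there) = sym (+-assoc (f zero) _ _)
sumOver-∪-⁅⁆ (outside ∷ S) f {suc v} v∉S = sumOver-∪-⁅⁆ S (f ∘ suc) (v∉S ∘ there)

sumOver-≤-∣∣* : ∀ (S : Subset n) (f : Fin n → ℕ) M → (∀ i → f i ≤ M) → sumOver S f ≤ ∣ S ∣ * M
sumOver-≤-∣∣* []            f M f≤M = z≤n
sumOver-≤-∣∣* (inside  ∷ S) f M f≤M = +-mono-≤ (f≤M zero) (sumOver-≤-∣∣* S (f ∘ suc) M (f≤M ∘ suc))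
sumOver-≤-∣∣* (outside ∷ S) f M f≤M = sumOver-≤-∣∣* S (f ∘ suc) M (f≤M ∘ suc)

update : (Fin n → ℕ) → Fin n → ℕ → Fin n → ℕ
update f v x w = if ⌊ w ≟ v ⌋ then x else f w

update-≡ : ∀ (f : Fin n → ℕ) v x → update f v x v ≡ x
update-≡ f v x with v ≟ v
... | yes _   = refl
... | no v≢v = ⊥-elim (v≢v refl)

update-≢ : ∀ (f : Fin n → ℕ) {v} x {w} → w ≢ v → update f v x w ≡ f w
update-≢ f {v} x {w} w≢v with w ≟ v
... | yes w≡v = ⊥-elim (w≢v w≡v)
... | no _    = refl

sumOver-update-∉ : ∀ (S : Subset n) (f : Fin n → ℕ) {v} x → v ∉ S → sumOver S (update f v x) ≡ sumOver S f
sumOver-update-∉ S f x v∉S = sumOver-cong S (λ i∈S → update-≢ f x (λ i≡v → v∉S (subst (_∈ S) i≡v i∈S)))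

∈-tabulate⁻ : ∀ (f : Fin n → Side) {x} → x ∈ tabulate f → f x ≡ inside
∈-tabulate⁻ f {x} x∈ = trans (sym (lookup∘tabulate f x)) ([]=⇒lookup x∈)

∈-tabulate⁺ : ∀ (f : Fin n → Side) {x} → f x ≡ inside → x ∈ tabulate f
∈-tabulate⁺ f {x} fx≡inside = lookup⇒[]= x _ (trans (lookup∘tabulate f x) fx≡inside)

fromBool≡inside⁻ : ∀ b → fromBool b ≡ inside → b ≡ true
fromBool≡inside⁻ true  _ = refl

isIn≡true⁻ : ∀ s → isIn s ≡ true → s ≡ inside
isIn≡true⁻ inside _ = refl

anyFin≡true⁻ : ∀ {m} (f : Fin m → Bool) → anyFin f ≡ true → ∃ λ i → f i ≡ true
anyFin≡true⁻ {suc m} f any with f zero in f0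
... | true  = zero , f0
... | false with anyFin≡true⁻ (f ∘ suc) any
...   | i , fi = suc i , fi

⌊≟⌋-sym : ∀ (v w : Fin n) → ⌊ v ≟ w ⌋ ≡ ⌊ w ≟ v ⌋
⌊≟⌋-sym v w with v ≟ w | w ≟ v
... | yes _   | yes _   = refl
... | no  _   | no  _   = refl
... | yes v≡w | no  w≢v = ⊥-elim (w≢v (sym v≡w))
... | no  v≢w | yes w≡v = ⊥-elim (v≢w (sym w≡v))

module Neighbourhoods (G : Graph n) where

  N : Fin n → Subset n
  N v = N[_] G v

  ∈N⁻ : ∀ {v w} → w ∈ N v → v ≡ w ⊎ adj G v w ≡ true
  ∈N⁻ {v} {w} w∈ with v ≟ w | fromBool≡inside⁻ _ (∈-tabulate⁻ _ w∈)
  ... | yes v≡w | _   = inj₁ v≡w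
  ... | no  _   | v~w = inj₂ v~w

  ∈N-sym : ∀ {v w} → w ∈ N v → v ∈ N w
  ∈N-sym {v} {w} w∈ = ∈-tabulate⁺ _
    (trans (cong fromBool (cong₂ _∨_ (⌊≟⌋-sym w v) (Graph.sym G w v))) (∈-tabulate⁻ _ w∈))

  ∈dominated⁻ : ∀ {S w} → w ∈ dominated G S → ∃ λ s → s ∈ S × w ∈ N s
  ∈dominated⁻ {S} {w} w∈ with anyFin≡true⁻ _ (fromBool≡inside⁻ _ (∈-tabulate⁻ _ w∈))
  ... | s , s∈S∧w∈Ns = s , lookup⇒[]= s S (isIn≡true⁻ _ (∧-conicalˡ _ _ s∈S∧w∈Ns))
                         , lookup⇒[]= w (N s) (isIn≡true⁻ _ (∧-conicalʳ _ _ s∈S∧w∈Ns))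

module Walks (G : Graph n) where
  open Neighbourhoods G

  walk-head : ∀ {T u v} → WalkIn G T u v → u ∈ T
  walk-head (here u∈)     = u∈
  walk-head (step u∈ _ _) = u∈

  walk-trans : ∀ {T u v w} → WalkIn G T u v → WalkIn G T v w → WalkIn G T u w
  walk-trans (here _)        q = q
  walk-trans (step u∈ u~x p) q = step u∈ u~x (walk-trans p q)

  walk-sym : ∀ {T u v} → WalkIn G T u v → WalkIn G T v u
  walk-sym (here u∈)               = here u∈
  walk-sym {u = u} (step u∈ u~x p) =
    walk-trans (walk-sym p) (step (walk-head p) (trans (Graph.sym G _ u) u~x) (here u∈))

  walk-⊆ : ∀ {S T u v} → S ⊆ T → WalkIn G S u v → WalkIn G T u v
  walk-⊆ S⊆T (here u∈)       = here (S⊆T u∈)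
  walk-⊆ S⊆T (step u∈ u~x p) = step (S⊆T u∈) u~x (walk-⊆ S⊆T p)

  ∈N-walk : ∀ {T v w} → w ∈ N v → v ∈ T → w ∈ T → WalkIn G T v w
  ∈N-walk w∈Nv v∈ w∈ with ∈N⁻ w∈Nv
  ... | inj₁ refl = here v∈
  ... | inj₂ v~w  = step v∈ v~w (here w∈)

  ∪-connected : ∀ {A T} → InducesConnected G T → (∀ {a} → a ∈ A → ∃ λ t → t ∈ T × a ∈ N t) →
                InducesConnected G (A ∪ T)
  ∪-connected {A} {T} T-connected A→T u v u∈ v∈ = connect (reach-T u∈) (reach-T v∈)
    where
    reach-T : ∀ {u} → u ∈ A ∪ T → ∃ λ t → t ∈ T × WalkIn G (A ∪ T) u t
    reach-T {u} u∈ with x∈p∪q⁻ A T u∈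
    ... | inj₂ u∈T = u , u∈T , here u∈
    ... | inj₁ u∈A with A→T u∈A
    ...   | t , t∈T , u∈Nt = t , t∈T , walk-sym (∈N-walk u∈Nt (q⊆p∪q A T t∈T) u∈)
    connect : (∃ λ t → t ∈ T × WalkIn G (A ∪ T) u t) → (∃ λ t → t ∈ T × WalkIn G (A ∪ T) v t) →
              WalkIn G (A ∪ T) u v
    connect (t , t∈T , u⇝t) (t′ , t′∈T , v⇝t′) =
      walk-trans u⇝t (walk-trans (walk-⊆ (q⊆p∪q A T) (T-connected t t′ t∈T t′∈T)) (walk-sym v⇝t′))

module Greedy (G : Graph n) where
  open Neighbourhoods G

  Exhausted : Subset n → Subset n → Set
  Exhausted D U = ∀ {d w} → d ∈ D → w ∈ U → w ∉ N d

  exhausted-initial : Exhausted ⊥ ⊤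
  exhausted-initial d∈⊥ _ = ⊥-elim (∉⊥ d∈⊥)

  exhausted-step : ∀ {D U p D₁ U₁ p₁} → Step G ⟨ D , U , p ⟩ ⟨ D₁ , U₁ , p₁ ⟩ → Exhausted D U → Exhausted D₁ U₁
  exhausted-step {D} {U} (pick v _ _ _) exhausted d∈ w∈ with x∈p∪q⁻ D ⁅ v ⁆ d∈ | x∈p─q⁻ U (N v) w∈
  ... | inj₁ d∈D   | w∈U , _    = exhausted d∈D w∈U
  ... | inj₂ d∈⁅v⁆ | _   , w∉Nv rewrite x∈⁅y⁆⇒x≡y v d∈⁅v⁆ = w∉Nv

  greedy-choice-max : ∀ {D U v} → Exhausted D U → (∀ u → u ∉ D → ∣ N u ∩ U ∣ ≤ ∣ N v ∩ U ∣) →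
                      ∀ s → ∣ N s ∩ U ∣ ≤ ∣ N v ∩ U ∣
  greedy-choice-max {D} {U} exhausted v-max s with s ∈? D
  ... | no  s∉D = v-max s s∉D
  ... | yes s∈D = subst (_≤ _) (sym (∣Empty∣≡0 Ns∩U-empty)) z≤n
    where
    Ns∩U-empty : Empty (N s ∩ U)
    Ns∩U-empty (w , w∈) with x∈p∩q⁻ (N s) U w∈
    ... | w∈Ns , w∈U = exhausted s∈D w∈U w∈Ns

  ∣dominated[S]∩U∣≤∣S∣*M : ∀ S U M → (∀ s → ∣ N s ∩ U ∣ ≤ M) → ∣ dominated G S ∩ U ∣ ≤ ∣ S ∣ * M
  ∣dominated[S]∩U∣≤∣S∣*M S U M bound = begin
    ∣ dominated G S ∩ U ∣                   ≤⟨ p⊆q⇒∣p∣≤∣q∣ cover ⟩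
    ∣ bigUnion S (λ s → N s ∩ U) ∣          ≤⟨ ∣bigUnion∣≤sumOver S (λ s → N s ∩ U) ⟩
    sumOver S (λ s → ∣ N s ∩ U ∣)           ≤⟨ sumOver-≤-∣∣* S _ M bound ⟩
    ∣ S ∣ * M                                ∎
    where
    open ≤-Reasoning
    cover : dominated G S ∩ U ⊆ bigUnion S (λ s → N s ∩ U)
    cover w∈ with x∈p∩q⁻ (dominated G S) U w∈
    ... | w∈dom , w∈U with ∈dominated⁻ w∈dom
    ...   | s , s∈S , w∈Ns = ∈-bigUnion⁺ S (λ s → N s ∩ U) s∈S (x∈p∩q⁺ (w∈Ns , w∈U))

module Approximation (G : Graph n) (k : ℕ) (1≤k : 1 ≤ k) (S* : Subset n) (∣S*∣≤k : ∣ S* ∣ ≤ k) where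
  open Neighbourhoods G
  open Walks G using (∪-connected)
  open Greedy G

  X : Subset n
  X = dominated G S*

  opt : ℕ
  opt = ∣ X ∣

  record Progress (D U : Subset n) (p : Fin n → ℕ) : Set where
    field
      c         : ℕ
      D′ W      : Subset n
      D′⊆D      : D′ ⊆ D
      c≤k       : c ≤ k
      ∣D′∣≤c    : ∣ D′ ∣ ≤ c
      ∣W∣≤c     : ∣ W ∣ ≤ c
      W⊆X       : W ⊆ X
      D′→W      : ∀ {d} → d ∈ D′ → ∃ λ w → w ∈ W × d ∈ N w
      decay     : ExpDecayBound k c (opt ∸ sumOver D′ p) opt
      uncovered : c < k → opt ≤ sumOver D′ p + ∣ X ∩ U ∣

  uncovered-step : ∀ {s U} v → opt ≤ s + ∣ X ∩ U ∣ → opt ≤ s + ∣ (N v ∩ U) ∩ X ∣ + ∣ X ∩ (U ─ N v) ∣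
  uncovered-step {s} {U} v opt≤ = begin
    opt                                            ≤⟨ opt≤ ⟩
    s + ∣ X ∩ U ∣                                  ≤⟨ +-monoʳ-≤ s (∣p∩q∣≤∣[r∩q]∩p∣+∣p∩[q─r]∣ X U (N v)) ⟩
    s + (∣ (N v ∩ U) ∩ X ∣ + ∣ X ∩ (U ─ N v) ∣)    ≡⟨ +-assoc s _ _ ⟨
    s + ∣ (N v ∩ U) ∩ X ∣ + ∣ X ∩ (U ─ N v) ∣      ∎
    where open ≤-Reasoning

  opt∸s≤k*∣N[v]∩U∣ : ∀ {D U v s} → Exhausted D U → (∀ u → u ∉ D → ∣ N u ∩ U ∣ ≤ ∣ N v ∩ U ∣) →
                     opt ≤ s + ∣ X ∩ U ∣ → opt ∸ s ≤ k * ∣ N v ∩ U ∣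
  opt∸s≤k*∣N[v]∩U∣ {D} {U} {v} {s} exhausted v-max opt≤ = begin
    opt ∸ s                ≤⟨ m≤n+o⇒m∸n≤o opt s opt≤ ⟩
    ∣ X ∩ U ∣              ≤⟨ ∣dominated[S]∩U∣≤∣S∣*M S* U _ (greedy-choice-max exhausted v-max) ⟩
    ∣ S* ∣ * ∣ N v ∩ U ∣   ≤⟨ *-monoˡ-≤ _ ∣S*∣≤k ⟩
    k * ∣ N v ∩ U ∣        ∎
    where open ≤-Reasoning

  progress-initial : Progress ⊥ ⊤ (λ _ → 0)
  progress-initial = record
    { c = 0 ; D′ = ⊥ ; W = ⊥
    ; D′⊆D = λ d∈ → d∈
    ; c≤k = z≤n
    ; ∣D′∣≤c = ≤-reflexive (∣⊥∣≡0 n)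
    ; ∣W∣≤c = ≤-reflexive (∣⊥∣≡0 n)
    ; W⊆X = ⊥-elim ∘ ∉⊥
    ; D′→W = ⊥-elim ∘ ∉⊥
    ; decay = λ m → subst (λ s → (opt ∸ s) * expTaylor k m 0 ≤ opt * expTaylor k m 0) (sym sum≡0) ≤-refl
    ; uncovered = λ _ → ≤-reflexive (sym (cong₂ _+_ sum≡0 (cong ∣_∣ (∩-identityʳ X))))
    }
    where
    sum≡0 : sumOver (⊥ {n = n}) (λ _ → 0) ≡ 0
    sum≡0 = sumOver-⊥ n (λ _ → 0)

  progress-keep : ∀ {D U p v} (P : Progress D U p) → v ∉ D →
                  (Progress.c P < k → opt ≤ sumOver (Progress.D′ P) p + ∣ X ∩ (U ─ N v) ∣) →
                  Progress (D ∪ ⁅ v ⁆) (U ─ N v) (update p v ∣ N v ∩ U ∣)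
  progress-keep {D} {U} {p} {v} P v∉D uncovered′ = record
    { c = c ; D′ = D′ ; W = W
    ; D′⊆D = p⊆p∪q ⁅ v ⁆ ∘ D′⊆D
    ; c≤k = c≤k
    ; ∣D′∣≤c = ∣D′∣≤c
    ; ∣W∣≤c = ∣W∣≤c
    ; W⊆X = W⊆X
    ; D′→W = D′→W
    ; decay = subst (λ s → ExpDecayBound k c (opt ∸ s) opt) (sym sum-unchanged) decay
    ; uncovered = subst (λ s → opt ≤ s + ∣ X ∩ (U ─ N v) ∣) (sym sum-unchanged) ∘ uncovered′
    }
    where
    open Progress P
    sum-unchanged : sumOver D′ (update p v ∣ N v ∩ U ∣) ≡ sumOver D′ p
    sum-unchanged = sumOver-update-∉ D′ p _ (v∉D ∘ D′⊆D)

  progress-extend : ∀ {D U p v w} (P : Progress D U p) → v ∉ D → Exhausted D U →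
                    (∀ u → u ∉ D → ∣ N u ∩ U ∣ ≤ ∣ N v ∩ U ∣) → Progress.c P < k → w ∈ (N v ∩ U) ∩ X →
                    Progress (D ∪ ⁅ v ⁆) (U ─ N v) (update p v ∣ N v ∩ U ∣)
  progress-extend {D} {U} {p} {v} {w} P v∉D exhausted v-max c<k w∈ = record
    { c = suc c ; D′ = D′ ∪ ⁅ v ⁆ ; W = W ∪ ⁅ w ⁆
    ; D′⊆D = ∪-⁅⁆-⊆ (p⊆p∪q ⁅ v ⁆ ∘ D′⊆D) (q⊆p∪q D ⁅ v ⁆ (x∈⁅x⁆ v))
    ; c≤k = c<k
    ; ∣D′∣≤c = ≤-trans (∣p∪⁅x⁆∣≤1+∣p∣ D′ v) (s≤s ∣D′∣≤c)
    ; ∣W∣≤c = ≤-trans (∣p∪⁅x⁆∣≤1+∣p∣ W w) (s≤s ∣W∣≤c)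
    ; W⊆X = ∪-⁅⁆-⊆ W⊆X w∈X
    ; D′→W = D′∪⁅v⁆→W∪⁅w⁆
    ; decay = subst (λ g → ExpDecayBound k (suc c) g opt) gap-shrinks
                    (expDecayBound-step k c (opt ∸ sum) pv opt 1≤k
                       (opt∸s≤k*∣N[v]∩U∣ exhausted v-max (uncovered c<k)) decay)
    ; uncovered = λ _ → uncovered′
    }
    where
    open Progress P
    pv = ∣ N v ∩ U ∣
    sum = sumOver D′ p
    w∈Nv : w ∈ N v
    w∈Nv = proj₁ (x∈p∩q⁻ (N v) U (proj₁ (x∈p∩q⁻ (N v ∩ U) X w∈)))
    w∈X : w ∈ X
    w∈X = proj₂ (x∈p∩q⁻ (N v ∩ U) X w∈)
    D′∪⁅v⁆→W∪⁅w⁆ : ∀ {d} → d ∈ D′ ∪ ⁅ v ⁆ → ∃ λ w′ → w′ ∈ W ∪ ⁅ w ⁆ × d ∈ N w′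
    D′∪⁅v⁆→W∪⁅w⁆ d∈ with x∈p∪q⁻ D′ ⁅ v ⁆ d∈
    ... | inj₂ d∈⁅v⁆ rewrite x∈⁅y⁆⇒x≡y v d∈⁅v⁆ = w , q⊆p∪q W ⁅ w ⁆ (x∈⁅x⁆ w) , ∈N-sym w∈Nv
    ... | inj₁ d∈D′ with D′→W d∈D′
    ...   | w′ , w′∈W , d∈Nw′ = w′ , p⊆p∪q ⁅ w ⁆ w′∈W , d∈Nw′
    sum-extended : sumOver (D′ ∪ ⁅ v ⁆) (update p v pv) ≡ sum + pv
    sum-extended = trans (sumOver-∪-⁅⁆ D′ _ (v∉D ∘ D′⊆D))
                         (cong₂ _+_ (sumOver-update-∉ D′ p pv (v∉D ∘ D′⊆D)) (update-≡ p v pv))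
    gap-shrinks : opt ∸ sum ∸ pv ≡ opt ∸ sumOver (D′ ∪ ⁅ v ⁆) (update p v pv)
    gap-shrinks = trans (∸-+-assoc opt sum pv) (cong (opt ∸_) (sym sum-extended))
    uncovered′ : opt ≤ sumOver (D′ ∪ ⁅ v ⁆) (update p v pv) + ∣ X ∩ (U ─ N v) ∣
    uncovered′ = begin
      opt
        ≤⟨ uncovered-step v (uncovered c<k) ⟩
      sum + ∣ (N v ∩ U) ∩ X ∣ + ∣ X ∩ (U ─ N v) ∣
        ≤⟨ +-monoˡ-≤ _ (+-monoʳ-≤ sum (∣p∩q∣≤∣p∣ (N v ∩ U) X)) ⟩
      sum + pv + ∣ X ∩ (U ─ N v) ∣
        ≡⟨ cong (_+ ∣ X ∩ (U ─ N v) ∣) sum-extended ⟨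
      sumOver (D′ ∪ ⁅ v ⁆) (update p v pv) + ∣ X ∩ (U ─ N v) ∣
        ∎
      where open ≤-Reasoning

  progress-step : ∀ {D U p D₁ U₁ p₁} → Exhausted D U → Progress D U p →
                  Step G ⟨ D , U , p ⟩ ⟨ D₁ , U₁ , p₁ ⟩ → Progress D₁ U₁ p₁
  progress-step {D} {U} {p} exhausted P (pick v _ v∉D v-max) with Progress.c P <? k | nonempty? ((N v ∩ U) ∩ X)
  ... | yes c<k | yes (w , w∈)  = progress-extend P v∉D exhausted v-max c<k w∈
  ... | yes _   | no  C∩X-empty = progress-keep P v∉D λ c<k →
    subst (λ s → opt ≤ s + ∣ X ∩ (U ─ N v) ∣) (trans (cong (sum +_) (∣Empty∣≡0 C∩X-empty)) (+-identityʳ sum))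
          (uncovered-step v (Progress.uncovered P c<k))
    where sum = sumOver (Progress.D′ P) p
  ... | no  c≮k | _            = progress-keep P v∉D (⊥-elim ∘ c≮k)

  progress-run : ∀ {D U p D₁ U₁ p₁} → Steps G ⟨ D , U , p ⟩ ⟨ D₁ , U₁ , p₁ ⟩ →
                 Exhausted D U → Progress D U p → Progress D₁ U₁ p₁
  progress-run done               _         P = P
  progress-run (more first rest) exhausted P =
    progress-run rest (exhausted-step first exhausted) (progress-step exhausted P first)

  progress-result : InducesConnected G S* → ∀ {D p} → Progress D ⊥ p →
                    Σ (Subset n) λ D′ → D′ ⊆ D × ∣ D′ ∣ ≤ k
                      × AtLeastOneMinusInvE (sumOver D′ p) opt
                      × (Σ (Subset n) λ S → ∣ S ∣ ≤ 2 * k × InducesConnected G (D′ ∪ S))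
  progress-result S*-connected {D} {p} P =
    D′ , D′⊆D , ≤-trans ∣D′∣≤c c≤k , approximation , W ∪ S* , ∣W∪S*∣≤2k , connected
    where
    open Progress P
    approximation : AtLeastOneMinusInvE (sumOver D′ p) opt
    approximation with c <? k
    ... | no  c≮k = atLeastOneMinusInvE k (sumOver D′ p) opt 1≤k
                      (subst (λ c → ExpDecayBound k c (opt ∸ sumOver D′ p) opt) (≤∧≮⇒≡ c≤k c≮k) decay)
    ... | yes c<k = λ m → subst (λ g → g * eNum m ≤ opt * m !) (sym (m≤n⇒m∸n≡0 opt≤sum)) z≤n
      where
      opt≤sum : opt ≤ sumOver D′ p
      opt≤sum = begin
        opt                            ≤⟨ uncovered c<k ⟩
        sumOver D′ p + ∣ X ∩ ⊥ ∣       ≡⟨ cong (λ A → sumOver D′ p + ∣ A ∣) (∩-zeroʳ X) ⟩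
        sumOver D′ p + ∣ ⊥ {n = n} ∣   ≡⟨ cong (sumOver D′ p +_) (∣⊥∣≡0 n) ⟩
        sumOver D′ p + 0               ≡⟨ +-identityʳ _ ⟩
        sumOver D′ p                   ∎
        where open ≤-Reasoning
    ∣W∪S*∣≤2k : ∣ W ∪ S* ∣ ≤ 2 * k
    ∣W∪S*∣≤2k = ≤-trans (∣p∪q∣≤∣p∣+∣q∣ W S*)
                  (subst (∣ W ∣ + ∣ S* ∣ ≤_) (cong (k +_) (sym (+-identityʳ k)))
                         (+-mono-≤ (≤-trans ∣W∣≤c c≤k) ∣S*∣≤k))
    connected : InducesConnected G (D′ ∪ (W ∪ S*))
    connected = ∪-connected (∪-connected S*-connected (∈dominated⁻ ∘ W⊆X)) D′→W∪S*
      where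
      D′→W∪S* : ∀ {d} → d ∈ D′ → ∃ λ w → w ∈ W ∪ S* × d ∈ N w
      D′→W∪S* d∈ with D′→W d∈
      ... | w , w∈W , d∈Nw = w , p⊆p∪q S* w∈W , d∈Nw

lemma2 : ∀ {n} (G : Graph n) (k : ℕ) → 1 ≤ k →
         (opt : ℕ) → IsOPT G k opt →
         (D : Subset n) (p : Fin n → ℕ) → GreedyOutput G D p →
         Σ (Subset n) λ D′ → D′ ⊆ D × ∣ D′ ∣ ≤ k
           × AtLeastOneMinusInvE (sumOver D′ p) opt
           × (Σ (Subset n) λ S → ∣ S ∣ ≤ 2 * k × InducesConnected G (D′ ∪ S))
lemma2 G k 1≤k .(∣ dominated G S* ∣) ((S* , (∣S*∣≤k , S*-connected) , refl) , _) D p greedy =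
  progress-result S*-connected (progress-run greedy (Greedy.exhausted-initial G) progress-initial)
  where open Approximation G k 1≤k S* ∣S*∣≤k
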